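{- Let $A$ be a $(0,1)$-matrix, let $A'$ be obtained from $A$ by a single interchange, and let $t\ge 2$ be an integer. Assume that $\rho_{t-1}(A')=\rho_{t-1}(A)+1$. Then \[\rho_t(A)\le \rho_t(A')\le \rho_t(A)+1.\]
   Context: For a $(0,1)$-matrix $A$ and positive integer $t$, the $t$-term rank $\rho_t(A)$ is the maximum number of $1$s of $A$ that can be chosen with at most one chosen $1$ in each column and at most $t$ chosen $1$s in each row. An interchange replaces a $2\times 2$ submatrix (in some rows $i_1<i_2$ and columns $j_1<j_2$) equal to $\begin{bmatrix}1&0\\0&1\end{bmatrix}$ by $\begin{bmatrix}0&1\\1&0\end{bmatrix}$, or vice versa. -}

module Defs where

open import Data.Nat using (ℕ; zero; suc; _+_; _≤_)
open import Data.Bool using (Bool; true; false; if_then_else_)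
open import Data.Fin using (Fin; _<_) renaming (zero to fzero; suc to fsuc)
open import Data.Fin.Properties using (_≟_)
open import Data.Maybe using (Maybe; just; nothing)
open import Data.Product using (Σ; _×_; _,_; ∃)
open import Data.Sum using (_⊎_)
open import Relation.Nullary.Decidable using (⌊_⌋)
open import Relation.Binary.PropositionalEquality using (_≡_; _≢_)

Matrix : ℕ → ℕ → Set
Matrix m n = Fin m → Fin n → Bool

count : {n : ℕ} → (Fin n → Bool) → ℕ
count {zero}  p = 0
count {suc n} p = (if p fzero then 1 else 0) + count (λ j → p (fsuc j))

isJust : {m : ℕ} → Maybe (Fin m) → Bool
isJust (just _) = true
isJust nothing  = false

isRow : {m : ℕ} → Fin m → Maybe (Fin m) → Bool
isRow i (just k) = ⌊ i ≟ k ⌋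
isRow i nothing  = false

-- A choice of 1s with at most one chosen 1 per column: each column j
-- either has no chosen 1 (nothing) or a chosen 1 in row i (just i).
Choice : ℕ → ℕ → Set
Choice m n = Fin n → Maybe (Fin m)

size : {m n : ℕ} → Choice m n → ℕ
size f = count (λ j → isJust (f j))

IsTChoice : {m n : ℕ} → ℕ → Matrix m n → Choice m n → Set
IsTChoice {m} {n} t A f =
  (∀ (j : Fin n) (i : Fin m) → f j ≡ just i → A i j ≡ true) ×
  (∀ (i : Fin m) → count (λ j → isRow i (f j)) ≤ t)

TermRank : {m n : ℕ} → ℕ → Matrix m n → ℕ → Set
TermRank t A r =
  (Σ _ λ f → IsTChoice t A f × size f ≡ r) ×
  (∀ f → IsTChoice t A f → size f ≤ r)

Interchange : {m n : ℕ} → Matrix m n → Matrix m n → Set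
Interchange {m} {n} A A' =
  Σ (Fin m) λ i₁ → Σ (Fin m) λ i₂ → Σ (Fin n) λ j₁ → Σ (Fin n) λ j₂ →
    i₁ < i₂ × j₁ < j₂ ×
    ((A i₁ j₁ ≡ true × A i₁ j₂ ≡ false × A i₂ j₁ ≡ false × A i₂ j₂ ≡ true ×
      A' i₁ j₁ ≡ false × A' i₁ j₂ ≡ true × A' i₂ j₁ ≡ true × A' i₂ j₂ ≡ false)
     ⊎
     (A i₁ j₁ ≡ false × A i₁ j₂ ≡ true × A i₂ j₁ ≡ true × A i₂ j₂ ≡ false ×
      A' i₁ j₁ ≡ true × A' i₁ j₂ ≡ false × A' i₂ j₁ ≡ false × A' i₂ j₂ ≡ true)) ×
    (∀ (i : Fin m) (j : Fin n) → ((i ≢ i₁ × i ≢ i₂) ⊎ (j ≢ j₁ × j ≢ j₂)) →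
       A' i j ≡ A i j)

-- The t-term rank obeys a König-type duality: ρₖ(B) is the minimum, over sets X of rows, of
-- k·|X| plus the number of columns having a 1 outside X. A k-choice has at most k·|X| of its 1s
-- in the rows of X and at most one in each column covered outside X; conversely, for a maximum
-- k-choice, the rows X reachable from unchosen columns by alternating paths are full (otherwise the
-- path augments the choice) and every column covered outside X is chosen outside X.
--
-- An interchange changes the cover term by at most one, which gives ρₜ(A') ≤ ρₜ(A) + 1. For the
-- other bound take optimal row sets I for ρₜ(A') and J for ρₜ₋₁(A). Since |I ∩ J| + |I ∪ J| =
-- |I| + |J|, and the cover terms are submodular up to an error of one caused by the two
-- interchanged columns, I ∩ J and I ∪ J witness ρₜ(A) + ρₜ₋₁(A') ≤ ρₜ(A') + ρₜ₋₁(A) + 1, and the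
-- hypothesis ρₜ₋₁(A') = ρₜ₋₁(A) + 1 leaves ρₜ(A) ≤ ρₜ(A').
module Submission where

open import Defs
open import Algebra.Bundles using (CommutativeMonoid)
open import Data.Nat using (ℕ; zero; suc; _+_; _*_; _∸_; _≤_; _<_; z≤n; s≤s; _≤ᵇ_)
open import Data.Nat.Properties
  using (+-*-semiring; +-commutativeSemigroup; +-mono-≤; +-monoˡ-≤; +-monoʳ-≤; +-assoc; +-comm;
         +-identityʳ; +-cancelʳ-≡; *-identityʳ; *-zeroʳ; *-comm; *-distribˡ-+; *-monoʳ-≤; ≤-refl; ≤-trans;
         ≤-reflexive; ≤-antisym; <-≤-trans; n≮n; ≰⇒>; _≤?_; m+n≤o⇒m≤o; ≤ᵇ⇒≤; +-cancelʳ-≤;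
         module ≤-Reasoning)
open import Data.Bool using (Bool; true; false; not; _∧_; _∨_; if_then_else_; T)
open import Data.Bool.Properties
  using (∨-identityʳ; ∨-zeroʳ; ∧-assoc; ∧-conicalˡ; ∧-conicalʳ; not-injective; not-¬; ¬-not; T-∧;
         ∨-commutativeMonoid)
  renaming (_≟_ to _≟ᵇ_)
open import Data.Fin using (Fin; punchIn) renaming (zero to fzero; suc to fsuc)
open import Data.Fin.Properties using (_≟_; punchInᵢ≢i; suc-injective; <⇒≢; any?)
open import Data.Maybe using (Maybe; just; nothing)
open import Data.Maybe.Properties using (just-injective)
open import Data.Product using (∃-syntax; _×_; _,_; proj₁; proj₂)
open import Data.Sum using (_⊎_; inj₁; inj₂; reduce)
open import Data.Unit using (tt)
open import Data.Vec using (Vec; []; _∷_)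
open import Data.Vec.Functional using (Vector; updateAt)
open import Data.Vec.Functional.Properties using (updateAt-updates; updateAt-minimal)
open import Function using (_∘_; const; Equivalence)
open import Relation.Nullary using (yes; no; contradiction)
open import Relation.Nullary.Decidable using (⌊_⌋; isYes≗does; dec-true; dec-false; _×-dec_)
open import Relation.Binary.PropositionalEquality

open import Algebra.Properties.Semiring.Sum +-*-semiring
  using (sum; sum-syntax; sum-cong-≗; sum-remove; sum-replicate-zero; ∑-distrib-+; ∑-comm; *-distribˡ-sum)
open import Algebra.Properties.CommutativeSemigroup +-commutativeSemigroup
  using (xy∙z≈zy∙x; xy∙z≈xz∙y; x∙yz≈xz∙y; interchange)
open import Algebra.Properties.CommutativeSemigroup
  (CommutativeMonoid.commutativeSemigroup ∨-commutativeMonoid)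
  using () renaming (interchange to ∨-interchange)

𝟙 : Bool → ℕ
𝟙 b = if b then 1 else 0

𝟙-mono : {a b : Bool} → (a ≡ true → b ≡ true) → 𝟙 a ≤ 𝟙 b
𝟙-mono {false} _ = z≤n
𝟙-mono {true} a⇒b rewrite a⇒b refl = ≤-refl

𝟙-∧-∨ : ∀ a b → 𝟙 (a ∧ b) + 𝟙 (a ∨ b) ≡ 𝟙 a + 𝟙 b
𝟙-∧-∨ true  true  = refl
𝟙-∧-∨ true  false = refl
𝟙-∧-∨ false b     = refl

⌊≟⌋-refl : ∀ {n} (i : Fin n) → ⌊ i ≟ i ⌋ ≡ true
⌊≟⌋-refl i = trans (isYes≗does (i ≟ i)) (dec-true (i ≟ i) refl)

⌊≟⌋-≢ : ∀ {n} {i j : Fin n} → i ≢ j → ⌊ i ≟ j ⌋ ≡ false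
⌊≟⌋-≢ {i = i} {j} i≢j = trans (isYes≗does (i ≟ j)) (dec-false (i ≟ j) i≢j)

count≡sum : ∀ {n} (p : Fin n → Bool) → count p ≡ ∑[ j < n ] 𝟙 (p j)
count≡sum {zero}  p = refl
count≡sum {suc n} p = cong (𝟙 (p fzero) +_) (count≡sum (p ∘ fsuc))

sum-mono-≤ : ∀ {n} {a b : Vector ℕ n} → (∀ j → a j ≤ b j) → sum a ≤ sum b
sum-mono-≤ {zero}  _   = z≤n
sum-mono-≤ {suc n} a≤b = +-mono-≤ (a≤b fzero) (sum-mono-≤ (a≤b ∘ fsuc))

sum-single : ∀ {n} {a : Vector ℕ n} (x : Fin n) → (∀ j → j ≢ x → a j ≡ 0) → sum a ≡ a x
sum-single {suc n} {a} x off = begin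
  sum a                              ≡⟨ sum-remove a ⟩
  a x + ∑[ j < n ] a (punchIn x j)   ≡⟨ cong (a x +_) (sum-cong-≗ (λ j → off _ (punchInᵢ≢i x j))) ⟩
  a x + ∑[ j < n ] 0                 ≡⟨ cong (a x +_) (sum-replicate-zero n) ⟩
  a x + 0                            ≡⟨ +-identityʳ (a x) ⟩
  a x                                ∎
  where open ≡-Reasoning

sum-≤-except : ∀ {n} {a b : Vector ℕ n} (x : Fin n) → (∀ j → j ≢ x → a j ≤ b j) →
               sum a + b x ≤ sum b + a x
sum-≤-except {suc n} {a} {b} x a≤b = begin
  sum a + b x                ≡⟨ cong (_+ b x) (sum-remove a) ⟩
  (a x + rest a) + b x       ≡⟨ xy∙z≈zy∙x (a x) (rest a) (b x) ⟩
  (b x + rest a) + a x       ≤⟨ +-monoˡ-≤ (a x) (+-monoʳ-≤ (b x) (sum-mono-≤ (λ j → a≤b _ (punchInᵢ≢i x j)))) ⟩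
  (b x + rest b) + a x       ≡⟨ cong (_+ a x) (sum-remove b) ⟨
  sum b + a x                ∎
  where
  open ≤-Reasoning
  rest : Vector ℕ (suc n) → ℕ
  rest c = ∑[ j < n ] c (punchIn x j)

sum-≡-except : ∀ {n} {a b : Vector ℕ n} (x : Fin n) → (∀ j → j ≢ x → a j ≡ b j) →
               sum a + b x ≡ sum b + a x
sum-≡-except x a≡b = ≤-antisym (sum-≤-except x (λ j j≢x → ≤-reflexive (a≡b j j≢x)))
                               (sum-≤-except x (λ j j≢x → ≤-reflexive (sym (a≡b j j≢x))))

-- Compare with the intermediate vector that agrees with a except at y, where it agrees with b.
sum-≤-except₂ : ∀ {n} {a b : Vector ℕ n} {x y : Fin n} (d : ℕ) → x ≢ y →
                (∀ j → j ≢ x → j ≢ y → a j ≤ b j) → a x + a y ≤ b x + b y + d →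
                sum a ≤ sum b + d
sum-≤-except₂ {a = a} {b} {x} {y} d x≢y a≤b axy = +-cancelʳ-≤ (b x + b y) (sum a) (sum b + d) (begin
  sum a + (b x + b y)        ≡⟨ x∙yz≈xz∙y (sum a) (b x) (b y) ⟩
  (sum a + b y) + b x        ≤⟨ +-monoˡ-≤ (b x) a-vs-c ⟩
  (sum c + a y) + b x        ≡⟨ xy∙z≈xz∙y (sum c) (a y) (b x) ⟩
  (sum c + b x) + a y        ≤⟨ +-monoˡ-≤ (a y) c-vs-b ⟩
  (sum b + a x) + a y        ≡⟨ +-assoc (sum b) (a x) (a y) ⟩
  sum b + (a x + a y)        ≤⟨ +-monoʳ-≤ (sum b) axy ⟩
  sum b + (b x + b y + d)    ≡⟨ cong (sum b +_) (+-comm (b x + b y) d) ⟩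
  sum b + (d + (b x + b y))  ≡⟨ +-assoc (sum b) d (b x + b y) ⟨
  sum b + d + (b x + b y)    ∎)
  where
  open ≤-Reasoning
  c : Vector ℕ _
  c = updateAt a y (const (b y))
  c-off : ∀ j → j ≢ y → c j ≡ a j
  c-off j j≢y = updateAt-minimal j y a j≢y
  a-vs-c : sum a + b y ≤ sum c + a y
  a-vs-c = subst (λ z → sum a + z ≤ sum c + a y) (updateAt-updates y a)
             (sum-≤-except y (λ j j≢y → ≤-reflexive (sym (c-off j j≢y))))
  c-vs-b : sum c + b x ≤ sum b + a x
  c-vs-b = subst (λ z → sum c + b x ≤ sum b + z) (c-off x x≢y) (sum-≤-except x c≤b)
    where
    c≤b : ∀ j → j ≢ x → c j ≤ b j
    c≤b j j≢x with j ≟ y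
    ... | yes refl = ≤-reflexive (updateAt-updates y a)
    ... | no j≢y   = subst (_≤ b j) (sym (c-off j j≢y)) (a≤b j j≢x j≢y)

_⊆_ : ∀ {n} → (Fin n → Bool) → (Fin n → Bool) → Set
p ⊆ q = ∀ j → p j ≡ true → q j ≡ true

count-mono : ∀ {n} {p q : Fin n → Bool} → p ⊆ q → count p ≤ count q
count-mono {p = p} {q} p⊆q = begin
  count p              ≡⟨ count≡sum p ⟩
  sum (𝟙 ∘ p)          ≤⟨ sum-mono-≤ (λ j → 𝟙-mono (p⊆q j)) ⟩
  sum (𝟙 ∘ q)          ≡⟨ count≡sum q ⟨
  count q              ∎
  where open ≤-Reasoning

count-< : ∀ {n} {p q : Fin n → Bool} (i : Fin n) → p ⊆ q → p i ≡ false → q i ≡ true →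
          count p < count q
count-< {p = p} {q} i p⊆q pi≡false qi≡true = begin
  suc (count p)             ≡⟨ +-comm 1 (count p) ⟩
  count p + 1               ≡⟨ cong₂ (λ c b → c + 𝟙 b) (count≡sum p) (sym qi≡true) ⟩
  sum (𝟙 ∘ p) + 𝟙 (q i)     ≤⟨ sum-≤-except i (λ j _ → 𝟙-mono (p⊆q j)) ⟩
  sum (𝟙 ∘ q) + 𝟙 (p i)     ≡⟨ cong₂ (λ c b → c + 𝟙 b) (sym (count≡sum q)) pi≡false ⟩
  count q + 0               ≡⟨ +-identityʳ (count q) ⟩
  count q                   ∎
  where open ≤-Reasoning

count-updateAt : ∀ {A : Set} {n} (P : A → Bool) (f : Vector A n) (j : Fin n) (v : A) →
                 count (P ∘ updateAt f j (const v)) + 𝟙 (P (f j)) ≡ count (P ∘ f) + 𝟙 (P v)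
count-updateAt P f j v = begin
  count (P ∘ g) + 𝟙 (P (f j))      ≡⟨ cong (_+ 𝟙 (P (f j))) (count≡sum (P ∘ g)) ⟩
  sum (𝟙 ∘ P ∘ g) + 𝟙 (P (f j))    ≡⟨ sum-≡-except j (λ k k≢j → cong (𝟙 ∘ P) (updateAt-minimal k j f k≢j)) ⟩
  sum (𝟙 ∘ P ∘ f) + 𝟙 (P (g j))    ≡⟨ cong₂ (λ c w → c + 𝟙 (P w)) (sym (count≡sum (P ∘ f))) (updateAt-updates j f) ⟩
  count (P ∘ f) + 𝟙 (P v)          ∎
  where
  open ≡-Reasoning
  g = updateAt f j (const v)

count+count≡sum : ∀ {n} (p q : Fin n → Bool) → count p + count q ≡ ∑[ j < n ] (𝟙 (p j) + 𝟙 (q j))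
count+count≡sum p q = trans (cong₂ _+_ (count≡sum p) (count≡sum q)) (sym (∑-distrib-+ (𝟙 ∘ p) (𝟙 ∘ q)))

count-∧-∨ : ∀ {n} (p q : Fin n → Bool) →
            count (λ i → p i ∧ q i) + count (λ i → p i ∨ q i) ≡ count p + count q
count-∧-∨ {n} p q = begin
  count (λ i → p i ∧ q i) + count (λ i → p i ∨ q i)  ≡⟨ count+count≡sum (λ i → p i ∧ q i) (λ i → p i ∨ q i) ⟩
  ∑[ i < n ] (𝟙 (p i ∧ q i) + 𝟙 (p i ∨ q i))         ≡⟨ sum-cong-≗ (λ i → 𝟙-∧-∨ (p i) (q i)) ⟩
  ∑[ i < n ] (𝟙 (p i) + 𝟙 (q i))                     ≡⟨ count+count≡sum p q ⟨
  count p + count q                                  ∎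
  where open ≡-Reasoning

any : ∀ {n} → (Fin n → Bool) → Bool
any {zero}  p = false
any {suc n} p = p fzero ∨ any (p ∘ fsuc)

any-intro : ∀ {n} {p : Fin n → Bool} (i : Fin n) → p i ≡ true → any p ≡ true
any-intro         fzero    pi≡true rewrite pi≡true = refl
any-intro {p = p} (fsuc i) pi≡true with p fzero
... | true  = refl
... | false = any-intro i pi≡true

any-elim : ∀ {n} {p : Fin n → Bool} → any p ≡ true → ∃[ i ] p i ≡ true
any-elim {suc n} {p} any≡true with p fzero in p0
... | true  = fzero , p0
... | false with any-elim any≡true
...   | i , pi≡true = fsuc i , pi≡true

any-cong : ∀ {n} {p q : Fin n → Bool} → (∀ i → p i ≡ q i) → any p ≡ any q
any-cong {zero}  _   = refl
any-cong {suc n} p≡q = cong₂ _∨_ (p≡q fzero) (any-cong (p≡q ∘ fsuc))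

any-mono : ∀ {n} {p q : Fin n → Bool} → p ⊆ q → any p ≡ true → any q ≡ true
any-mono p⊆q any≡true with any-elim any≡true
... | i , pi≡true = any-intro i (p⊆q i pi≡true)

any-∨ : ∀ {n} (p q : Fin n → Bool) → any (λ i → p i ∨ q i) ≡ any p ∨ any q
any-∨ {zero}  p q = refl
any-∨ {suc n} p q = trans (cong ((p fzero ∨ q fzero) ∨_) (any-∨ (p ∘ fsuc) (q ∘ fsuc)))
                          (∨-interchange (p fzero) (q fzero) _ _)

any-at : ∀ {n} {p : Fin n → Bool} (x : Fin n) → (∀ i → i ≢ x → p i ≡ false) → any p ≡ p x
any-at {suc n} {p} fzero off =
  trans (cong (p fzero ∨_) (trans (any-cong (λ i → off (fsuc i) λ ())) (any-false n)))
        (∨-identityʳ (p fzero))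
  where
  any-false : ∀ n → any {n} (λ _ → false) ≡ false
  any-false zero    = refl
  any-false (suc n) = any-false n
any-at {suc n} {p} (fsuc x) off =
  trans (cong (_∨ any (p ∘ fsuc)) (off fzero λ ())) (any-at x (λ i i≢x → off (fsuc i) (i≢x ∘ suc-injective)))

-- The indices x and y may coincide.
any-split : ∀ {n} (p : Fin n → Bool) (x y : Fin n) →
            any p ≡ p x ∨ (p y ∨ any (λ i → not (⌊ i ≟ x ⌋ ∨ ⌊ i ≟ y ⌋) ∧ p i))
any-split {n} p x y = begin
  any p
    ≡⟨ any-cong (λ i → split ⌊ i ≟ x ⌋ ⌊ i ≟ y ⌋ (p i)) ⟩
  any (λ i → (⌊ i ≟ x ⌋ ∧ p i) ∨ ((⌊ i ≟ y ⌋ ∧ p i) ∨ rest i))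
    ≡⟨ any-∨ (at-part x) (λ i → at-part y i ∨ rest i) ⟩
  any (at-part x) ∨ any (λ i → at-part y i ∨ rest i)
    ≡⟨ cong₂ _∨_ (at x) (trans (any-∨ (at-part y) rest) (cong (_∨ any rest) (at y))) ⟩
  p x ∨ (p y ∨ any rest) ∎
  where
  open ≡-Reasoning
  rest : Fin n → Bool
  rest i = not (⌊ i ≟ x ⌋ ∨ ⌊ i ≟ y ⌋) ∧ p i
  split : ∀ a b c → c ≡ (a ∧ c) ∨ ((b ∧ c) ∨ (not (a ∨ b) ∧ c))
  split true  b     true  = refl
  split true  true  false = refl
  split true  false false = refl
  split false true  true  = refl
  split false true  false = refl
  split false false c     = refl
  at-part : Fin n → Fin n → Bool
  at-part z i = ⌊ i ≟ z ⌋ ∧ p i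
  at : ∀ z → any (at-part z) ≡ p z
  at z = trans (any-at z (λ i i≢z → cong (_∧ p i) (⌊≟⌋-≢ i≢z))) (cong (_∧ p z) (⌊≟⌋-refl z))

allTrue : ∀ n → (Vec Bool n → Bool) → Bool
allTrue zero    φ = φ []
allTrue (suc n) φ = allTrue n (φ ∘ (true ∷_)) ∧ allTrue n (φ ∘ (false ∷_))

allTrue-sound : ∀ n (φ : Vec Bool n → Bool) → T (allTrue n φ) → ∀ v → T (φ v)
allTrue-sound zero    φ t []          = t
allTrue-sound (suc n) φ t (true ∷ v)  = allTrue-sound n _ (proj₁ (Equivalence.to T-∧ t)) v
allTrue-sound (suc n) φ t (false ∷ v) = allTrue-sound n _ (proj₂ (Equivalence.to T-∧ t)) v

-- Duality for the t-term rank

infixr 7 _∩_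
infixr 6 _∪_

_∩_ _∪_ : ∀ {m} → (Fin m → Bool) → (Fin m → Bool) → Fin m → Bool
(X ∩ Y) i = X i ∧ Y i
(X ∪ Y) i = X i ∨ Y i

covered : ∀ {m n} → Matrix m n → (Fin m → Bool) → Fin n → Bool
covered B X j = any (λ i → B i j ∧ not (X i))

coverSize : ∀ {m n} → Matrix m n → (Fin m → Bool) → ℕ
coverSize B X = count (covered B X)

cost : ∀ {m n} → ℕ → Matrix m n → (Fin m → Bool) → ℕ
cost k B X = k * count X + coverSize B X

covered-∩ : ∀ {m n} (B : Matrix m n) X Y j → covered B (X ∩ Y) j ≡ covered B X j ∨ covered B Y j
covered-∩ B X Y j =
  trans (any-cong (λ i → distrib (B i j) (X i) (Y i))) (any-∨ (λ i → B i j ∧ not (X i)) (λ i → B i j ∧ not (Y i)))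
  where
  distrib : ∀ b x y → b ∧ not (x ∧ y) ≡ (b ∧ not x) ∨ (b ∧ not y)
  distrib false x     y = refl
  distrib true  true  y = refl
  distrib true  false y = refl

covered-∪ : ∀ {m n} (B : Matrix m n) X Y j →
            covered B (X ∪ Y) j ≡ true → covered B X j ∧ covered B Y j ≡ true
covered-∪ B X Y j c = cong₂ _∧_ (any-mono (λ i → left (B i j) (X i) (Y i)) c)
                                 (any-mono (λ i → right (B i j) (X i) (Y i)) c)
  where
  left : ∀ b x y → b ∧ not (x ∨ y) ≡ true → b ∧ not x ≡ true
  left true false y _ = refl
  right : ∀ b x y → b ∧ not (x ∨ y) ≡ true → b ∧ not y ≡ true
  right true false false _ = refl
  right true true  y     ()

withoutRows : ∀ {m n} → Fin m → Fin m → Matrix m n → Matrix m n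
withoutRows p q B i j = not (⌊ i ≟ p ⌋ ∨ ⌊ i ≟ q ⌋) ∧ B i j

covered-split : ∀ {m n} (B : Matrix m n) p q X j →
  covered B X j ≡ (B p j ∧ not (X p)) ∨ ((B q j ∧ not (X q)) ∨ covered (withoutRows p q B) X j)
covered-split B p q X j = trans (any-split (λ i → B i j ∧ not (X i)) p q)
  (cong (λ c → (B p j ∧ not (X p)) ∨ ((B q j ∧ not (X q)) ∨ c))
        (any-cong (λ i → sym (∧-assoc (not (⌊ i ≟ p ⌋ ∨ ⌊ i ≟ q ⌋)) (B i j) (not (X i))))))

rowLoad : ∀ {m n} → Choice m n → Fin m → ℕ
rowLoad f i = count (λ j → isRow i (f j))

assign : ∀ {m n} → Choice m n → Fin n → Fin m → Choice m n
assign f j i = updateAt f j (const (just i))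

inside : ∀ {m} → (Fin m → Bool) → Maybe (Fin m) → Bool
inside X (just i) = X i
inside X nothing  = false

feeds : ∀ {m} → (Fin m → Bool) → Maybe (Fin m) → Bool
feeds X (just i) = X i
feeds X nothing  = true

-- A column chosen in a row outside X.
outside : ∀ {m} → (Fin m → Bool) → Maybe (Fin m) → Bool
outside X v = not (feeds X v)

size-split : ∀ {m n} (X : Fin m → Bool) (f : Choice m n) →
             size f ≡ count (inside X ∘ f) + count (outside X ∘ f)
size-split {n = n} X f = begin
  size f                                                 ≡⟨ count≡sum (isJust ∘ f) ⟩
  ∑[ j < n ] 𝟙 (isJust (f j))                            ≡⟨ sum-cong-≗ (λ j → split (f j)) ⟩
  ∑[ j < n ] (𝟙 (inside X (f j)) + 𝟙 (outside X (f j)))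
    ≡⟨ count+count≡sum (inside X ∘ f) (outside X ∘ f) ⟨
  count (inside X ∘ f) + count (outside X ∘ f)           ∎
  where
  open ≡-Reasoning
  split : ∀ v → 𝟙 (isJust v) ≡ 𝟙 (inside X v) + 𝟙 (outside X v)
  split nothing  = refl
  split (just i) with X i
  ... | true  = refl
  ... | false = refl

inside≡sum : ∀ {m} (X : Fin m → Bool) v → 𝟙 (inside X v) ≡ ∑[ i < m ] (𝟙 (X i) * 𝟙 (isRow i v))
inside≡sum {m} X nothing  = sym (trans (sum-cong-≗ (λ i → *-zeroʳ (𝟙 (X i)))) (sum-replicate-zero m))
inside≡sum {m} X (just y) = sym (begin
  ∑[ i < m ] (𝟙 (X i) * 𝟙 (isRow i (just y)))
    ≡⟨ sum-single y (λ i i≢y → trans (cong (λ b → 𝟙 (X i) * 𝟙 b) (⌊≟⌋-≢ i≢y)) (*-zeroʳ (𝟙 (X i)))) ⟩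
  𝟙 (X y) * 𝟙 ⌊ y ≟ y ⌋
    ≡⟨ cong (λ b → 𝟙 (X y) * 𝟙 b) (⌊≟⌋-refl y) ⟩
  𝟙 (X y) * 1
    ≡⟨ *-identityʳ (𝟙 (X y)) ⟩
  𝟙 (X y) ∎)
  where open ≡-Reasoning

count-inside : ∀ {m n} (X : Fin m → Bool) (f : Choice m n) →
               count (inside X ∘ f) ≡ ∑[ i < m ] (𝟙 (X i) * rowLoad f i)
count-inside {m} {n} X f = begin
  count (inside X ∘ f)
    ≡⟨ count≡sum (inside X ∘ f) ⟩
  ∑[ j < n ] 𝟙 (inside X (f j))
    ≡⟨ sum-cong-≗ (λ j → inside≡sum X (f j)) ⟩
  ∑[ j < n ] ∑[ i < m ] (𝟙 (X i) * 𝟙 (isRow i (f j)))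
    ≡⟨ ∑-comm (λ j i → 𝟙 (X i) * 𝟙 (isRow i (f j))) ⟩
  ∑[ i < m ] ∑[ j < n ] (𝟙 (X i) * 𝟙 (isRow i (f j)))
    ≡⟨ sum-cong-≗ (λ i → *-distribˡ-sum (𝟙 (X i)) (λ j → 𝟙 (isRow i (f j)))) ⟨
  ∑[ i < m ] (𝟙 (X i) * ∑[ j < n ] 𝟙 (isRow i (f j)))
    ≡⟨ sum-cong-≗ (λ i → cong (𝟙 (X i) *_) (count≡sum (λ j → isRow i (f j)))) ⟨
  ∑[ i < m ] (𝟙 (X i) * rowLoad f i) ∎
  where open ≡-Reasoning

*-count≡sum : ∀ {m} (k : ℕ) (X : Fin m → Bool) → k * count X ≡ ∑[ i < m ] (𝟙 (X i) * k)
*-count≡sum {m} k X = begin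
  k * count X                    ≡⟨ cong (k *_) (count≡sum X) ⟩
  k * (∑[ i < m ] 𝟙 (X i))       ≡⟨ *-distribˡ-sum k (𝟙 ∘ X) ⟩
  ∑[ i < m ] (k * 𝟙 (X i))       ≡⟨ sum-cong-≗ (λ i → *-comm k (𝟙 (X i))) ⟩
  ∑[ i < m ] (𝟙 (X i) * k)       ∎
  where open ≡-Reasoning

size≤cost : ∀ {m n k} {B : Matrix m n} {f : Choice m n} → IsTChoice k B f → ∀ X → size f ≤ cost k B X
size≤cost {m} {k = k} {B} {f} (onOnes , bounded) X = begin
  size f                                                ≡⟨ size-split X f ⟩
  count (inside X ∘ f) + count (outside X ∘ f)          ≡⟨ cong (_+ count (outside X ∘ f)) (count-inside X f) ⟩
  (∑[ i < m ] (𝟙 (X i) * rowLoad f i)) + count (outside X ∘ f)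
    ≤⟨ +-mono-≤ (sum-mono-≤ (λ i → *-monoʳ-≤ (𝟙 (X i)) (bounded i))) (count-mono outside⇒covered) ⟩
  (∑[ i < m ] (𝟙 (X i) * k)) + coverSize B X           ≡⟨ cong (_+ coverSize B X) (*-count≡sum k X) ⟨
  cost k B X                                            ∎
  where
  open ≤-Reasoning
  outside⇒covered : (outside X ∘ f) ⊆ covered B X
  outside⇒covered j o with f j in fj
  outside⇒covered j () | nothing
  ... | just i = any-intro i (cong₂ _∧_ (onOnes j i fj) o)

-- Row i is reached from an unchosen column by an alternating path through at most h chosen 1s.
data Reachable {m n} (B : Matrix m n) (f : Choice m n) : ℕ → Fin m → Set where
  free : ∀ {h i} j → f j ≡ nothing → B i j ≡ true → Reachable B f h i
  via  : ∀ {h i y} j → f j ≡ just y → Reachable B f h y → B i j ≡ true → Reachable B f (suc h) i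

module _ {m n} {B : Matrix m n} where

  weaken : ∀ {f h i} → Reachable B f h i → Reachable B f (suc h) i
  weaken (free j fj Bij)   = free j fj Bij
  weaken (via j fj r Bij)  = via j fj (weaken r) Bij

  -- Moving column j (chosen in row y) can only break paths through y, which is then itself reachable.
  reachable-assign : ∀ {f j y h x} i → f j ≡ just y → Reachable B f h x →
                     Reachable B (assign f j i) h x ⊎ Reachable B (assign f j i) h y
  reachable-assign {f} {j} i fj (free j′ fj′ Bxj′) with j′ ≟ j
  ... | yes refl = contradiction (trans (sym fj′) fj) λ ()
  ... | no j′≢j  = inj₁ (free j′ (trans (updateAt-minimal j′ j f j′≢j) fj′) Bxj′)
  reachable-assign {f} {j} i fj (via j′ fj′ r Bxj′) with reachable-assign i fj r
  ... | inj₂ ry = inj₂ (weaken ry)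
  ... | inj₁ ry′ with j′ ≟ j
  ...   | yes refl = inj₂ (weaken (subst (Reachable B _ _) (just-injective (trans (sym fj′) fj)) ry′))
  ...   | no j′≢j  = inj₁ (via j′ (trans (updateAt-minimal j′ j f j′≢j) fj′) ry′ Bxj′)

  assign-valid : ∀ {k f j i} → IsTChoice k B f → B i j ≡ true → rowLoad f i < k →
                 IsTChoice k B (assign f j i) × (∀ i′ → rowLoad (assign f j i) i′ + 𝟙 (isRow i′ (f j)) ≤ k)
  assign-valid {k} {f} {j} {i} (onOnes , bounded) Bij slack =
    (onOnes′ , λ i′ → m+n≤o⇒m≤o _ (bounded′ i′)) , bounded′
    where
    onOnes′ : ∀ j′ i′ → assign f j i j′ ≡ just i′ → B i′ j′ ≡ true
    onOnes′ j′ i′ e with j′ ≟ j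
    ... | yes refl = subst (λ z → B z j ≡ true) (just-injective (trans (sym (updateAt-updates j f)) e)) Bij
    ... | no j′≢j  = onOnes j′ i′ (trans (sym (updateAt-minimal j′ j f j′≢j)) e)
    bounded′ : ∀ i′ → rowLoad (assign f j i) i′ + 𝟙 (isRow i′ (f j)) ≤ k
    bounded′ i′ rewrite count-updateAt (isRow i′) f j (just i) with i′ ≟ i
    ... | yes refl = subst (_≤ k) (+-comm 1 (rowLoad f i)) slack
    ... | no _     = subst (_≤ k) (sym (+-identityʳ (rowLoad f i′))) (bounded i′)

  augment : ∀ {k f h i} → IsTChoice k B f → Reachable B f h i → rowLoad f i < k →
            ∃[ g ] IsTChoice k B g × size g ≡ suc (size f)
  augment {k} {f} {i = i} valid (free j fj Bij) slack =
    assign f j i , proj₁ (assign-valid valid Bij slack) , size-g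
    where
    size-g : size (assign f j i) ≡ suc (size f)
    size-g = trans (sym (+-identityʳ _))
             (trans (subst (λ v → size (assign f j i) + 𝟙 (isJust v) ≡ size f + 1) fj
                           (count-updateAt isJust f j (just i)))
                    (+-comm (size f) 1))
  augment {k} {f} {i = i} valid (via {y = y} j fj r Bij) slack
    with assign-valid {j = j} valid Bij slack
  ... | valid′ , bounded′ with augment valid′ (reduce (reachable-assign i fj r)) slack-y
    where
    slack-y : rowLoad (assign f j i) y < k
    slack-y = subst (_≤ k) (trans (cong (λ b → rowLoad (assign f j i) y + 𝟙 b) (⌊≟⌋-refl y)) (+-comm _ 1))
                    (subst (λ v → rowLoad (assign f j i) y + 𝟙 (isRow y v) ≤ k) fj (bounded′ y))
  ...   | g , valid-g , size-g = g , valid-g , trans size-g (cong suc (+-cancelʳ-≡ 1 _ _ sizes))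
    where
    sizes : size (assign f j i) + 1 ≡ size f + 1
    sizes = subst (λ v → size (assign f j i) + 𝟙 (isJust v) ≡ size f + 1) fj
                  (count-updateAt isJust f j (just i))

-- The closure is built by adding one missing index at a time; the indices outside X bound the recursion.
saturate : ∀ {m} (P : Fin m → Set) (step : (Fin m → Bool) → Fin m → Bool) →
           (∀ X i → (∀ i → X i ≡ true → P i) → step X i ≡ true → P i) →
           ∃[ X ] (∀ i → X i ≡ true → P i) × (∀ i → step X i ≡ true → X i ≡ true)
saturate {m} P step grow = go _ (λ _ → false) ≤-refl (λ _ ())
  where
  Sound Closed : (Fin m → Bool) → Set
  Sound X  = ∀ i → X i ≡ true → P i
  Closed X = ∀ i → step X i ≡ true → X i ≡ true
  go : ∀ fuel X → count (not ∘ X) ≤ fuel → Sound X → ∃[ X ] Sound X × Closed X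
  go fuel X bound sound with any? (λ i → (X i ≟ᵇ false) ×-dec (step X i ≟ᵇ true))
  ... | no none = X , sound , closed
    where
    closed : Closed X
    closed i s with X i in Xi
    ... | true  = refl
    ... | false = contradiction (i , Xi , s) none
  ... | yes (i , Xi , s) = descend fuel (<-≤-trans shrink bound)
    where
    X′ : Fin m → Bool
    X′ k = X k ∨ ⌊ k ≟ i ⌋
    shrink : count (not ∘ X′) < count (not ∘ X)
    shrink = count-< i (λ k → not-∨ˡ (X k))
                     (cong not (trans (cong (X i ∨_) (⌊≟⌋-refl i)) (∨-zeroʳ (X i))))
                     (cong not Xi)
      where
      not-∨ˡ : ∀ a {b} → not (a ∨ b) ≡ true → not a ≡ true
      not-∨ˡ false _ = refl
    sound′ : Sound X′
    sound′ k X′k with X k in Xk | k ≟ i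
    ... | true  | _        = sound k Xk
    ... | false | yes refl = grow X i sound s
    sound′ k () | false | no _
    descend : ∀ fuel → count (not ∘ X′) < fuel → ∃[ X ] Sound X × Closed X
    descend (suc fuel) (s≤s bound′) = go fuel X′ bound′ sound′

module _ {m n k} {B : Matrix m n} {f : Choice m n} (valid : IsTChoice k B f)
         (maximal : ∀ g → IsTChoice k B g → size g ≤ size f) where

  private
    opens : (Fin m → Bool) → Fin m → Bool
    opens X i = any (λ j → feeds X (f j) ∧ B i j)

    reachable-opens : ∀ X i → (∀ i → X i ≡ true → ∃[ h ] Reachable B f h i) →
                      opens X i ≡ true → ∃[ h ] Reachable B f h i
    reachable-opens X i sound o with any-elim o
    ... | j , e with f j in fj
    ...   | nothing = 0 , free j fj e
    ...   | just y with sound y (∧-conicalˡ _ _ e)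
    ...     | h , r = suc h , via j fj r (∧-conicalʳ _ _ e)

  -- X consists of the rows reachable from unchosen columns: they are full, since a reachable row
  -- with slack would let augment enlarge the maximal f.
  cost≤size : ∃[ X ] cost k B X ≤ size f
  cost≤size with saturate _ opens reachable-opens
  ... | X , reach , closed = X , (begin
    cost k B X                                          ≡⟨ cong (_+ coverSize B X) (*-count≡sum k X) ⟩
    (∑[ i < m ] (𝟙 (X i) * k)) + coverSize B X
      ≤⟨ +-mono-≤ (sum-mono-≤ weigh) (count-mono covered⇒outside) ⟩
    (∑[ i < m ] (𝟙 (X i) * rowLoad f i)) + count (outside X ∘ f)
      ≡⟨ cong (_+ count (outside X ∘ f)) (count-inside X f) ⟨
    count (inside X ∘ f) + count (outside X ∘ f)        ≡⟨ size-split X f ⟨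
    size f                                              ∎)
    where
    open ≤-Reasoning
    full : ∀ i → X i ≡ true → k ≤ rowLoad f i
    full i Xi with k ≤? rowLoad f i
    ... | yes k≤load = k≤load
    ... | no  k≰load with reach i Xi
    ...   | h , r with augment valid r (≰⇒> k≰load)
    ...     | g , valid-g , size-g = contradiction (subst (_≤ size f) size-g (maximal g valid-g)) (n≮n _)
    weigh : ∀ i → 𝟙 (X i) * k ≤ 𝟙 (X i) * rowLoad f i
    weigh i with X i in Xi
    ... | true  = *-monoʳ-≤ 1 (full i Xi)
    ... | false = z≤n
    covered⇒outside : covered B X ⊆ (outside X ∘ f)
    covered⇒outside j c with any-elim c
    ... | i , e = cong not (¬-not feeds≢true)
      where
      feeds≢true : feeds X (f j) ≢ true
      feeds≢true feeds≡true =
        not-¬ (closed i (any-intro j (cong₂ _∧_ feeds≡true (∧-conicalˡ _ _ e))))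
              (not-injective (∧-conicalʳ _ _ e))

termRank≤cost : ∀ {m n k r} {B : Matrix m n} → TermRank k B r → ∀ X → r ≤ cost k B X
termRank≤cost {k = k} {B = B} ((f , valid , size≡r) , _) X =
  subst (_≤ cost k B X) size≡r (size≤cost valid X)

cost≤termRank : ∀ {m n k r} {B : Matrix m n} → TermRank k B r → ∃[ X ] cost k B X ≤ r
cost≤termRank ((f , valid , refl) , maximal) = cost≤size valid maximal

weighted-exchange : ∀ u {l k i j} → l + k ≡ i + j → l ≤ i → suc u * l + u * k ≤ suc u * i + u * j
weighted-exchange u {l} {k} {i} {j} l+k≡i+j l≤i = begin
  suc u * l + u * k     ≡⟨ +-assoc l (u * l) (u * k) ⟩
  l + (u * l + u * k)   ≡⟨ cong (l +_) (*-distribˡ-+ u l k) ⟨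
  l + u * (l + k)       ≤⟨ +-mono-≤ l≤i (≤-reflexive (cong (u *_) l+k≡i+j)) ⟩
  i + u * (i + j)       ≡⟨ cong (i +_) (*-distribˡ-+ u i j) ⟩
  i + (u * i + u * j)   ≡⟨ +-assoc i (u * i) (u * j) ⟨
  suc u * i + u * j     ∎
  where open ≤-Reasoning

-- The effect of an interchange

record OrientedInterchange {m n} (A A' : Matrix m n) : Set where
  field
    p q : Fin m
    x y : Fin n
    x≢y : x ≢ y
    A-px  : A p x ≡ true
    A-qy  : A q y ≡ true
    A-py  : A p y ≡ false
    A-qx  : A q x ≡ false
    A'-px : A' p x ≡ false
    A'-qy : A' q y ≡ false
    A'-py : A' p y ≡ true
    A'-qx : A' q x ≡ true
    rows-agree    : ∀ i j → i ≢ p → i ≢ q → A' i j ≡ A i j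
    columns-agree : ∀ i j → j ≢ x → j ≢ y → A' i j ≡ A i j

orient : ∀ {m n} {A A' : Matrix m n} → Interchange A A' → OrientedInterchange A A'
orient (i₁ , i₂ , j₁ , j₂ , _ , j₁<j₂ , inj₁ (a₁₁ , a₁₂ , a₂₁ , a₂₂ , a′₁₁ , a′₁₂ , a′₂₁ , a′₂₂) , agree) = record
  { p = i₁ ; q = i₂ ; x = j₁ ; y = j₂ ; x≢y = <⇒≢ j₁<j₂
  ; A-px = a₁₁ ; A-qy = a₂₂ ; A-py = a₁₂ ; A-qx = a₂₁
  ; A'-px = a′₁₁ ; A'-qy = a′₂₂ ; A'-py = a′₁₂ ; A'-qx = a′₂₁
  ; rows-agree    = λ i j i≢p i≢q → agree i j (inj₁ (i≢p , i≢q))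
  ; columns-agree = λ i j j≢x j≢y → agree i j (inj₂ (j≢x , j≢y))
  }
orient (i₁ , i₂ , j₁ , j₂ , _ , j₁<j₂ , inj₂ (a₁₁ , a₁₂ , a₂₁ , a₂₂ , a′₁₁ , a′₁₂ , a′₂₁ , a′₂₂) , agree) = record
  { p = i₁ ; q = i₂ ; x = j₂ ; y = j₁ ; x≢y = ≢-sym (<⇒≢ j₁<j₂)
  ; A-px = a₁₂ ; A-qy = a₂₁ ; A-py = a₁₁ ; A-qx = a₂₂
  ; A'-px = a′₁₂ ; A'-qy = a′₂₁ ; A'-py = a′₁₁ ; A'-qx = a′₂₂
  ; rows-agree    = λ i j i≢p i≢q → agree i j (inj₁ (i≢p , i≢q))
  ; columns-agree = λ i j j≢y j≢x → agree i j (inj₂ (j≢x , j≢y))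
  }

-- Columns x and y in cover-exchange and cover-swap: Ip records p ∈ I, and uˣ, vˣ (uʸ, vʸ) record
-- whether column x (y) has a 1 in a row other than p, q outside I, resp. J.
exchange-bits : ∀ Ip Iq Jp Jq uˣ vˣ uʸ vʸ →
  (𝟙 (not (Ip ∧ Jp) ∨ (uˣ ∨ vˣ)) + 𝟙 (not (Iq ∨ Jq) ∨ (uˣ ∧ vˣ))) +
  (𝟙 (not (Iq ∧ Jq) ∨ (uʸ ∨ vʸ)) + 𝟙 (not (Ip ∨ Jp) ∨ (uʸ ∧ vʸ)))
  ≤ (𝟙 (not Iq ∨ uˣ) + 𝟙 (not Jp ∨ vˣ)) + (𝟙 (not Ip ∨ uʸ) + 𝟙 (not Jq ∨ vʸ)) + 1
exchange-bits Ip Iq Jp Jq uˣ vˣ uʸ vʸ =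
  ≤ᵇ⇒≤ _ _ (allTrue-sound 8 φ tt (Ip ∷ Iq ∷ Jp ∷ Jq ∷ uˣ ∷ vˣ ∷ uʸ ∷ vʸ ∷ []))
  where
  φ : Vec Bool 8 → Bool
  φ (Ip ∷ Iq ∷ Jp ∷ Jq ∷ uˣ ∷ vˣ ∷ uʸ ∷ vʸ ∷ []) =
    ((𝟙 (not (Ip ∧ Jp) ∨ (uˣ ∨ vˣ)) + 𝟙 (not (Iq ∨ Jq) ∨ (uˣ ∧ vˣ))) +
     (𝟙 (not (Iq ∧ Jq) ∨ (uʸ ∨ vʸ)) + 𝟙 (not (Ip ∨ Jp) ∨ (uʸ ∧ vʸ))))
    ≤ᵇ ((𝟙 (not Iq ∨ uˣ) + 𝟙 (not Jp ∨ vˣ)) + (𝟙 (not Ip ∨ uʸ) + 𝟙 (not Jq ∨ vʸ)) + 1)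

swap-bits : ∀ Ip Iq uˣ uʸ → 𝟙 (not Iq ∨ uˣ) + 𝟙 (not Ip ∨ uʸ) ≤ 𝟙 (not Ip ∨ uˣ) + 𝟙 (not Iq ∨ uʸ) + 1
swap-bits Ip Iq uˣ uʸ = ≤ᵇ⇒≤ _ _ (allTrue-sound 4 φ tt (Ip ∷ Iq ∷ uˣ ∷ uʸ ∷ []))
  where
  φ : Vec Bool 4 → Bool
  φ (Ip ∷ Iq ∷ uˣ ∷ uʸ ∷ []) =
    (𝟙 (not Iq ∨ uˣ) + 𝟙 (not Ip ∨ uʸ)) ≤ᵇ (𝟙 (not Ip ∨ uˣ) + 𝟙 (not Iq ∨ uʸ) + 1)

module _ {m n} {A A' : Matrix m n} (σ : OrientedInterchange A A') where
  open OrientedInterchange σ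

  private
    rest : (Fin m → Bool) → Fin n → Bool
    rest = covered (withoutRows p q A)

    rest-A' : ∀ X j → covered (withoutRows p q A') X j ≡ rest X j
    rest-A' X j = any-cong (λ i → cong (_∧ not (X i)) (agree i))
      where
      agree : ∀ i → withoutRows p q A' i j ≡ withoutRows p q A i j
      agree i with i ≟ p | i ≟ q
      ... | yes _   | _       = refl
      ... | no _    | yes _   = refl
      ... | no i≢p  | no i≢q  = cong (true ∧_) (rows-agree i j i≢p i≢q)

    rest-∩ : ∀ I J j → rest (I ∩ J) j ≡ rest I j ∨ rest J j
    rest-∩ = covered-∩ (withoutRows p q A)

    covered-A-x : ∀ X → covered A X x ≡ not (X p) ∨ rest X x
    covered-A-x X rewrite covered-split A p q X x | A-px | A-qx = refl

    covered-A-y : ∀ X → covered A X y ≡ not (X q) ∨ rest X y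
    covered-A-y X rewrite covered-split A p q X y | A-py | A-qy = refl

    covered-A'-x : ∀ X → covered A' X x ≡ not (X q) ∨ rest X x
    covered-A'-x X rewrite covered-split A' p q X x | A'-px | A'-qx | rest-A' X x = refl

    covered-A'-y : ∀ X → covered A' X y ≡ not (X p) ∨ rest X y
    covered-A'-y X rewrite covered-split A' p q X y | A'-py | A'-qy | rest-A' X y = refl

    covered-A'-off : ∀ X j → j ≢ x → j ≢ y → covered A' X j ≡ covered A X j
    covered-A'-off X j j≢x j≢y = any-cong (λ i → cong (_∧ not (X i)) (columns-agree i j j≢x j≢y))

    ∨-monoʳ : ∀ a {b c} → (b ≡ true → c ≡ true) → a ∨ b ≡ true → a ∨ c ≡ true
    ∨-monoʳ true  _   _ = refl
    ∨-monoʳ false b⇒c e = b⇒c e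

  cover-exchange : ∀ I J → coverSize A (I ∩ J) + coverSize A' (I ∪ J) ≤ coverSize A' I + coverSize A J + 1
  cover-exchange I J = begin
    coverSize A (I ∩ J) + coverSize A' (I ∪ J)
      ≡⟨ count+count≡sum (covered A (I ∩ J)) (covered A' (I ∪ J)) ⟩
    ∑[ j < n ] (𝟙 (covered A (I ∩ J) j) + 𝟙 (covered A' (I ∪ J) j))
      ≤⟨ sum-≤-except₂ 1 x≢y off at-xy ⟩
    ∑[ j < n ] (𝟙 (covered A' I j) + 𝟙 (covered A J j)) + 1
      ≡⟨ cong (_+ 1) (count+count≡sum (covered A' I) (covered A J)) ⟨
    coverSize A' I + coverSize A J + 1 ∎
    where
    open ≤-Reasoning
    off : ∀ j → j ≢ x → j ≢ y →
          𝟙 (covered A (I ∩ J) j) + 𝟙 (covered A' (I ∪ J) j) ≤ 𝟙 (covered A' I j) + 𝟙 (covered A J j)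
    off j j≢x j≢y = begin
      𝟙 (covered A (I ∩ J) j) + 𝟙 (covered A' (I ∪ J) j)
        ≡⟨ cong₂ (λ a b → 𝟙 a + 𝟙 b) (covered-∩ A I J j) (covered-A'-off (I ∪ J) j j≢x j≢y) ⟩
      𝟙 (cI ∨ cJ) + 𝟙 (covered A (I ∪ J) j)
        ≤⟨ +-monoʳ-≤ (𝟙 (cI ∨ cJ)) (𝟙-mono (covered-∪ A I J j)) ⟩
      𝟙 (cI ∨ cJ) + 𝟙 (cI ∧ cJ)
        ≡⟨ +-comm (𝟙 (cI ∨ cJ)) (𝟙 (cI ∧ cJ)) ⟩
      𝟙 (cI ∧ cJ) + 𝟙 (cI ∨ cJ)
        ≡⟨ 𝟙-∧-∨ cI cJ ⟩
      𝟙 cI + 𝟙 cJ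
        ≡⟨ cong (λ a → 𝟙 a + 𝟙 cJ) (covered-A'-off I j j≢x j≢y) ⟨
      𝟙 (covered A' I j) + 𝟙 cJ ∎
      where
      cI = covered A I j
      cJ = covered A J j
    at-xy : (𝟙 (covered A (I ∩ J) x) + 𝟙 (covered A' (I ∪ J) x)) +
            (𝟙 (covered A (I ∩ J) y) + 𝟙 (covered A' (I ∪ J) y))
            ≤ (𝟙 (covered A' I x) + 𝟙 (covered A J x)) + (𝟙 (covered A' I y) + 𝟙 (covered A J y)) + 1
    at-xy rewrite covered-A-x (I ∩ J) | covered-A'-x (I ∪ J) | covered-A-y (I ∩ J) | covered-A'-y (I ∪ J)
                | covered-A'-x I | covered-A-x J | covered-A'-y I | covered-A-y J
                | rest-∩ I J x | rest-∩ I J y =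
      ≤-trans (+-mono-≤ (+-monoʳ-≤ (𝟙 (not (I p ∧ J p) ∨ (rest I x ∨ rest J x)))
                                   (𝟙-mono (∨-monoʳ (not (I q ∨ J q)) (covered-∪ (withoutRows p q A) I J x))))
                        (+-monoʳ-≤ (𝟙 (not (I q ∧ J q) ∨ (rest I y ∨ rest J y)))
                                   (𝟙-mono (∨-monoʳ (not (I p ∨ J p)) (covered-∪ (withoutRows p q A) I J y)))))
              (exchange-bits (I p) (I q) (J p) (J q) (rest I x) (rest J x) (rest I y) (rest J y))

  cover-swap : ∀ I → coverSize A' I ≤ coverSize A I + 1
  cover-swap I = begin
    coverSize A' I                   ≡⟨ count≡sum (covered A' I) ⟩
    ∑[ j < n ] 𝟙 (covered A' I j)    ≤⟨ sum-≤-except₂ 1 x≢y off at-xy ⟩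
    ∑[ j < n ] 𝟙 (covered A I j) + 1 ≡⟨ cong (_+ 1) (count≡sum (covered A I)) ⟨
    coverSize A I + 1                ∎
    where
    open ≤-Reasoning
    off : ∀ j → j ≢ x → j ≢ y → 𝟙 (covered A' I j) ≤ 𝟙 (covered A I j)
    off j j≢x j≢y = ≤-reflexive (cong 𝟙 (covered-A'-off I j j≢x j≢y))
    at-xy : 𝟙 (covered A' I x) + 𝟙 (covered A' I y) ≤ 𝟙 (covered A I x) + 𝟙 (covered A I y) + 1
    at-xy rewrite covered-A'-x I | covered-A'-y I | covered-A-x I | covered-A-y I =
      swap-bits (I p) (I q) (rest I x) (rest I y)

  cost-exchange : ∀ u I J → cost (suc u) A (I ∩ J) + cost u A' (I ∪ J) ≤ cost (suc u) A' I + cost u A J + 1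
  cost-exchange u I J = begin
    (suc u * count (I ∩ J) + coverSize A (I ∩ J)) + (u * count (I ∪ J) + coverSize A' (I ∪ J))
      ≡⟨ interchange (suc u * count (I ∩ J)) _ (u * count (I ∪ J)) _ ⟩
    (suc u * count (I ∩ J) + u * count (I ∪ J)) + (coverSize A (I ∩ J) + coverSize A' (I ∪ J))
      ≤⟨ +-mono-≤ (weighted-exchange u (count-∧-∨ I J) (count-mono (λ i → ∧-conicalˡ (I i) (J i))))
                  (cover-exchange I J) ⟩
    (suc u * count I + u * count J) + (coverSize A' I + coverSize A J + 1)
      ≡⟨ +-assoc (suc u * count I + u * count J) _ 1 ⟨
    (suc u * count I + u * count J) + (coverSize A' I + coverSize A J) + 1
      ≡⟨ cong (_+ 1) (interchange (suc u * count I) (u * count J) (coverSize A' I) (coverSize A J)) ⟩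
    cost (suc u) A' I + cost u A J + 1 ∎
    where open ≤-Reasoning

  cost-swap : ∀ k I → cost k A' I ≤ cost k A I + 1
  cost-swap k I = subst (cost k A' I ≤_) (sym (+-assoc (k * count I) (coverSize A I) 1))
                        (+-monoʳ-≤ (k * count I) (cover-swap I))

proposition2p5 : (m n : ℕ) (A A' : Matrix m n) (t : ℕ) → 2 ≤ t →
    Interchange A A' →
    (r r' : ℕ) → TermRank (t ∸ 1) A r → TermRank (t ∸ 1) A' r' → r' ≡ r + 1 →
    (s s' : ℕ) → TermRank t A s → TermRank t A' s' →
    s ≤ s' × s' ≤ s + 1
proposition2p5 m n A A' zero ()
proposition2p5 m n A A' (suc u) _ interchange r r' ρ ρ' refl s s' σ σ' = s≤s' , s'≤s+1
  where
  oriented : OrientedInterchange A A'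
  oriented = orient interchange
  s≤s' : s ≤ s'
  s≤s' with cost≤termRank σ' | cost≤termRank ρ
  ... | I , I-optimal | J , J-optimal = +-cancelʳ-≤ (r + 1) s s' (begin
    s + (r + 1)                                 ≤⟨ +-mono-≤ (termRank≤cost σ (I ∩ J)) (termRank≤cost ρ' (I ∪ J)) ⟩
    cost (suc u) A (I ∩ J) + cost u A' (I ∪ J)  ≤⟨ cost-exchange oriented u I J ⟩
    cost (suc u) A' I + cost u A J + 1          ≤⟨ +-monoˡ-≤ 1 (+-mono-≤ I-optimal J-optimal) ⟩
    s' + r + 1                                  ≡⟨ +-assoc s' r 1 ⟩
    s' + (r + 1)                                ∎)
    where open ≤-Reasoning
  s'≤s+1 : s' ≤ s + 1
  s'≤s+1 with cost≤termRank σ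
  ... | X , X-optimal = begin
    s'                     ≤⟨ termRank≤cost σ' X ⟩
    cost (suc u) A' X      ≤⟨ cost-swap oriented (suc u) X ⟩
    cost (suc u) A X + 1   ≤⟨ +-monoˡ-≤ 1 X-optimal ⟩
    s + 1                  ∎
    where open ≤-Reasoning
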